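{- Let $d\ge 3$, let $p,q,r\ge 0$ be integers, $S=[p,q,r]$, and let $G$ be a $d$-regular graph with girth larger than $3\max(p,q,r)$. Then the common degree $b_S$ of the links of $G_S$ is nonzero if and only if (i) $p,q,r$ are all even, or (ii) $p+q+r$ is even and $p,q,r$ satisfy the triangle inequality.
   Context: With $\rho$ the graph metric of $G$, $G_S$ has vertex set $V(G)^3$, and $(x_1,x_2,x_3)\sim(y_1,y_2,y_3)$ iff $[\rho(x_1,y_1),\rho(x_2,y_2),\rho(x_3,y_3)]=S$ as multisets. Every link (subgraph induced on the neighbours of a vertex) of $G_S$ is $b_S$-regular. -}

module Defs where

open import Data.Nat using (ℕ; zero; suc; _+_; _≤_; _<_)
open import Data.Nat.Divisibility using (_∣_)
open import Data.Fin using (Fin)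
open import Data.Maybe using (just)
open import Data.List using (List; []; _∷_; length; head; last)
open import Data.List.Membership.Propositional using (_∈_)
open import Data.List.Relation.Unary.Unique.Propositional using (Unique)
open import Data.List.Relation.Unary.Linked using (Linked)
open import Data.List.Relation.Binary.Permutation.Propositional using (_↭_)
open import Data.Product using (Σ; ∃; ∃-syntax; _×_; _,_)
open import Data.Sum using (_⊎_)
open import Relation.Nullary using (¬_)
open import Relation.Binary.PropositionalEquality using (_≡_)

record Graph (n : ℕ) : Set₁ where
  field
    _~_     : Fin n → Fin n → Set
    sym~    : ∀ {x y} → x ~ y → y ~ x
    irrefl~ : ∀ {x} → ¬ (x ~ x)

module _ {n : ℕ} (G : Graph n) where
  open Graph G

  Regular : ℕ → Set
  Regular d = ∀ x → Σ (List (Fin n)) λ ns →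
    length ns ≡ d × Unique ns × (∀ y → y ∈ ns → x ~ y) × (∀ y → x ~ y → y ∈ ns)

  data Walk : Fin n → Fin n → ℕ → Set where
    nil  : ∀ {x} → Walk x x 0
    cons : ∀ {x y z k} → x ~ y → Walk y z k → Walk x z (suc k)

  -- graph metric: ρ(x,y) = k  (no such k when x,y lie in different components)
  Dist : Fin n → Fin n → ℕ → Set
  Dist x y k = Walk x y k × (∀ m → m < k → ¬ Walk x y m)

  HasCycle : ℕ → Set
  HasCycle k = Σ (List (Fin n)) λ l →
    length l ≡ k × 3 ≤ k × Unique l × Linked _~_ l ×
    (∃[ a ] ∃[ b ] (head l ≡ just a × last l ≡ just b × b ~ a))

  GirthGreaterThan : ℕ → Set
  GirthGreaterThan g = ∀ k → HasCycle k → g < k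

  -- adjacency in G_S with S = [p,q,r] (multiset equality via permutation)
  AdjS : ℕ → ℕ → ℕ → (Fin n × Fin n × Fin n) → (Fin n × Fin n × Fin n) → Set
  AdjS p q r (x₁ , x₂ , x₃) (y₁ , y₂ , y₃) =
    ∃[ a ] ∃[ b ] ∃[ c ]
      (Dist x₁ y₁ a × Dist x₂ y₂ b × Dist x₃ y₃ c ×
       (a ∷ b ∷ c ∷ []) ↭ (p ∷ q ∷ r ∷ []))

  -- b_S ≠ 0: in the link of every vertex X of G_S, every vertex Y has
  -- a neighbour Z in that link (i.e. degree of Y in link(X) is positive)
  LinkDegreeNonzero : ℕ → ℕ → ℕ → Set
  LinkDegreeNonzero p q r = ∀ X Y → AdjS p q r X Y →
    ∃[ Z ] (AdjS p q r X Z × AdjS p q r Z Y)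

max3 : ℕ → ℕ → ℕ → ℕ
max3 p q r = p Data.Nat.⊔ (q Data.Nat.⊔ r)

AllEven : ℕ → ℕ → ℕ → Set
AllEven p q r = 2 ∣ p × 2 ∣ q × 2 ∣ r

TriangleIneq : ℕ → ℕ → ℕ → Set
TriangleIneq p q r = p ≤ q + r × q ≤ p + r × r ≤ p + q

-- Below the girth every ball of G is a tree, so all distances that occur are tree distances.
-- Three points of a tree at pairwise distances a, b, c span a tripod, which exists iff
-- (a, b, c) satisfies the triangle inequality and a + b + c is even; conversely, since
-- d ≥ 3, every such tripod can be grown around a geodesic of length c.  Hence Z is a common
-- neighbour of X and Y in G_S exactly when, coordinatewise, the distance profiles of X → Z
-- and Z → Y are permutations of S forming tripods with the profile of X → Y.  Whether two
-- such permutations exist for the profile S itself is a finite question about pairs of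
-- permutations of three indices: either some coordinate uses all three entries of S (which
-- is then a tripod), or every entry of S is the third side of an isosceles tripod, hence even.

module Submission where

open import Defs
open import Data.Nat using (ℕ; zero; suc; _+_; _*_; _≤_; _<_; _⊔_; z≤n; s≤s)
open import Data.Nat.Properties
open import Data.Nat.Divisibility using (_∣_; divides; ∣m+n∣m⇒∣n)
open import Data.Nat.Tactic.RingSolver using (solve-∀)
open import Data.Fin using (Fin; #_) renaming (zero to fzero; suc to fsuc)
open import Data.Fin.Properties using (any?; all?) renaming (_≟_ to _≟ᶠ_)
open import Data.Vec using (Vec; []; _∷_; lookup)
open import Data.Vec.Properties using (≡-dec)
open import Data.List using (List; []; _∷_; length; last)
open import Data.List.Properties using (∷-injectiveˡ)
open import Data.List.Membership.Propositional using (_∈_)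
import Data.List.Membership.DecPropositional as DecMembership
open import Data.List.Relation.Unary.Any using (here; there)
open import Data.List.Relation.Unary.All as All using (All; []; _∷_)
open import Data.List.Relation.Unary.All.Properties using (¬Any⇒All¬)
open import Data.List.Relation.Unary.AllPairs using ([]; _∷_)
open import Data.List.Relation.Unary.Unique.Propositional using (Unique)
open import Data.List.Relation.Unary.Linked using (Linked; [-]; _∷_)
open import Data.List.Relation.Binary.Sublist.Propositional using (_⊆_; []; _∷_; _∷ʳ_; minimum)
open import Data.List.Relation.Binary.Sublist.Propositional.Properties using (All-resp-⊆; length-mono-≤)
open import Data.List.Relation.Binary.Permutation.Propositional
  using (_↭_; ↭-refl; ↭-sym; ↭-trans; prep; swap)
open import Data.List.Relation.Binary.Permutation.Propositional.Properties
  using (∈-resp-↭; drop-∷; ↭-singleton-inv; shift)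
open import Data.Maybe using (just)
open import Data.Product using (Σ; ∃-syntax; _×_; _,_; proj₁; proj₂)
open import Data.Sum using (_⊎_; inj₁; inj₂)
open import Data.Empty using (⊥-elim)
open import Data.Unit using (⊤; tt)
open import Function using (id; _∘_)
open import Function.Bundles using (_⇔_; mk⇔; Equivalence)
open import Relation.Nullary using (¬_; Dec; yes; no)
open import Relation.Nullary.Decidable using (toWitness; _×-dec_; _⊎-dec_)
open import Relation.Binary.Definitions using (DecidableEquality)
open import Relation.Binary.PropositionalEquality

module _ {A : Set} {a b c : A} where

  first : a ∈ (a ∷ b ∷ c ∷ [])
  first = here refl

  second : b ∈ (a ∷ b ∷ c ∷ [])
  second = there (here refl)

  third : c ∈ (a ∷ b ∷ c ∷ [])
  third = there (there (here refl))

TreeTriangle : ℕ → ℕ → ℕ → Set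
TreeTriangle a b c = 2 ∣ (a + b + c) × TriangleIneq a b c

module _ {a b c : ℕ} where

  TreeTriangle-rotate : TreeTriangle a b c → TreeTriangle b c a
  TreeTriangle-rotate (even , a≤b+c , b≤a+c , c≤a+b) =
    subst (2 ∣_) (rearrange a b c) even ,
    subst (b ≤_) (+-comm a c) b≤a+c , subst (c ≤_) (+-comm a b) c≤a+b , a≤b+c
    where
      rearrange : ∀ a b c → a + b + c ≡ b + c + a
      rearrange = solve-∀

  TreeTriangle-swap : TreeTriangle a b c → TreeTriangle b a c
  TreeTriangle-swap (even , a≤b+c , b≤a+c , c≤a+b) =
    subst (2 ∣_) (cong (_+ c) (+-comm a b)) even ,
    b≤a+c , a≤b+c , subst (c ≤_) (+-comm a b) c≤a+b

even-of-isosceles : ∀ {a c} → TreeTriangle a a c → 2 ∣ c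
even-of-isosceles {a} (even , _) = ∣m+n∣m⇒∣n even (divides a (double a))
  where
    double : ∀ a → a + a ≡ a * 2
    double = solve-∀

TreeTriangle-equilateral : ∀ {c} → 2 ∣ c → TreeTriangle c c c
TreeTriangle-equilateral {c} (divides h c≡h*2) =
  divides (h + c) (trans (cong (c + c +_) c≡h*2) (sum h c)) , m≤m+n c c , m≤m+n c c , m≤m+n c c
  where
    sum : ∀ h c → c + c + h * 2 ≡ (h + c) * 2
    sum = solve-∀

≤-half : ∀ {x y} → x + x ≤ y + y → x ≤ y
≤-half x+x≤y+y = ≮⇒≥ (λ y<x → <⇒≱ (+-mono-< y<x y<x) x+x≤y+y)

≤-half-sum : ∀ {x y z h} → x ≤ y + z → x + y + z ≡ h + h → x ≤ h
≤-half-sum {x} {y} {z} x≤y+z eq =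
  ≤-half (subst (x + x ≤_) (trans (sym (+-assoc x y z)) eq) (+-monoʳ-≤ x x≤y+z))

gaps-sum : ∀ x y {z ξ η h} → x + ξ ≡ h → y + η ≡ h → x + y + z ≡ h + h → ξ + η ≡ z
gaps-sum x y {z} {ξ} {η} x+ξ≡h y+η≡h eq =
  +-cancelˡ-≡ (x + y) (ξ + η) z (trans (regroup x y ξ η) (trans (cong₂ _+_ x+ξ≡h y+η≡h) (sym eq)))
  where
    regroup : ∀ x y ξ η → x + y + (ξ + η) ≡ x + ξ + (y + η)
    regroup = solve-∀

-- The legs are the gaps h ∸ b, h ∸ a, h ∸ c, where a + b + c = 2h.
tripod-legs : ∀ {a b c} → TreeTriangle a b c →
  ∃[ s ] ∃[ t ] ∃[ l ] (s + t ≡ c × s + l ≡ a × t + l ≡ b)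
tripod-legs {a} {b} {c} (divides h a+b+c≡h*2 , a≤b+c , b≤a+c , c≤a+b) =
  legs (gap a≤b+c abc) (gap b≤a+c bac) (gap c≤a+b cab)
  where
    abc : a + b + c ≡ h + h
    abc = trans a+b+c≡h*2 (twice h)
      where
        twice : ∀ h → h * 2 ≡ h + h
        twice = solve-∀
    bca : b + c + a ≡ h + h
    bca = trans (+-comm (b + c) a) (trans (sym (+-assoc a b c)) abc)
    cab : c + a + b ≡ h + h
    cab = trans (+-comm (c + a) b) (trans (sym (+-assoc b c a)) bca)
    bac : b + a + c ≡ h + h
    bac = trans (cong (_+ c) (+-comm b a)) abc
    acb : a + c + b ≡ h + h
    acb = trans (cong (_+ b) (+-comm a c)) cab
    gap : ∀ {x y z} → x ≤ y + z → x + y + z ≡ h + h → ∃[ ξ ] x + ξ ≡ h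
    gap x≤y+z eq = m≤n⇒∃[o]m+o≡n (≤-half-sum x≤y+z eq)
    legs : ∃[ α ] a + α ≡ h → ∃[ β ] b + β ≡ h → ∃[ γ ] c + γ ≡ h →
      ∃[ s ] ∃[ t ] ∃[ l ] (s + t ≡ c × s + l ≡ a × t + l ≡ b)
    legs (α , a+α≡h) (β , b+β≡h) (γ , c+γ≡h) =
      β , α , γ , gaps-sum b a b+β≡h a+α≡h bac , gaps-sum b c b+β≡h c+γ≡h bca ,
      gaps-sum a c a+α≡h c+γ≡h acb

Index : Set
Index = Fin 3

permutations : List (Vec Index 3)
permutations = (# 0 ∷ # 1 ∷ # 2 ∷ []) ∷ (# 0 ∷ # 2 ∷ # 1 ∷ []) ∷ (# 1 ∷ # 0 ∷ # 2 ∷ []) ∷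
        (# 1 ∷ # 2 ∷ # 0 ∷ []) ∷ (# 2 ∷ # 0 ∷ # 1 ∷ []) ∷ (# 2 ∷ # 1 ∷ # 0 ∷ []) ∷ []

reindexed : ∀ {A : Set} → Vec A 3 → Vec Index 3 → Index → A
reindexed v σ i = lookup v (lookup σ i)

↭-pair : ∀ {A : Set} {a b x y : A} → (a ∷ b ∷ []) ↭ (x ∷ y ∷ []) → (a ≡ x × b ≡ y) ⊎ (a ≡ y × b ≡ x)
↭-pair {x = x} {y} π with ∈-resp-↭ π (here refl)
... | here refl = inj₁ (refl , ∷-injectiveˡ (↭-singleton-inv (drop-∷ π)))
... | there (here refl) =
  inj₂ (refl , ∷-injectiveˡ (↭-singleton-inv (drop-∷ (↭-trans π (swap x y ↭-refl)))))

module _ {A : Set} {x y z : A} where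

  private
    v : Vec A 3
    v = x ∷ y ∷ z ∷ []

  ↭-reindex : ∀ {a b c} → (a ∷ b ∷ c ∷ []) ↭ (x ∷ y ∷ z ∷ []) →
    ∃[ σ ] σ ∈ permutations ×
      a ≡ reindexed v σ (# 0) × b ≡ reindexed v σ (# 1) × c ≡ reindexed v σ (# 2)
  ↭-reindex π with ∈-resp-↭ π (here refl)
  ... | here refl with ↭-pair (drop-∷ π)
  ...   | inj₁ (refl , refl) = _ , here refl , refl , refl , refl
  ...   | inj₂ (refl , refl) = _ , there (here refl) , refl , refl , refl
  ↭-reindex π | there (here refl) with ↭-pair (drop-∷ (↭-trans π (swap x y ↭-refl)))
  ...   | inj₁ (refl , refl) = _ , there (there (here refl)) , refl , refl , refl
  ...   | inj₂ (refl , refl) = _ , there (there (there (here refl))) , refl , refl , refl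
  ↭-reindex π | there (there (here refl))
    with ↭-pair (drop-∷ (↭-trans π (↭-trans (prep x (swap y z ↭-refl)) (swap x z ↭-refl))))
  ...   | inj₁ (refl , refl) = _ , there (there (there (there (here refl)))) , refl , refl , refl
  ...   | inj₂ (refl , refl) = _ , there (there (there (there (there (here refl))))) , refl , refl , refl

module _ {x y z : ℕ} where

  private
    v : Vec ℕ 3
    v = x ∷ y ∷ z ∷ []

  TreeTriangle-reindex : ∀ {σ} → σ ∈ permutations →
    TreeTriangle x y z ⇔ TreeTriangle (reindexed v σ (# 0)) (reindexed v σ (# 1)) (reindexed v σ (# 2))
  TreeTriangle-reindex (here refl) = mk⇔ id id
  TreeTriangle-reindex (there (here refl)) = mk⇔ transpose transpose
    where
      transpose : ∀ {a b c} → TreeTriangle a b c → TreeTriangle a c b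
      transpose = TreeTriangle-swap ∘ TreeTriangle-rotate ∘ TreeTriangle-rotate
  TreeTriangle-reindex (there (there (here refl))) = mk⇔ TreeTriangle-swap TreeTriangle-swap
  TreeTriangle-reindex (there (there (there (here refl)))) =
    mk⇔ TreeTriangle-rotate (TreeTriangle-rotate ∘ TreeTriangle-rotate)
  TreeTriangle-reindex (there (there (there (there (here refl))))) =
    mk⇔ (TreeTriangle-rotate ∘ TreeTriangle-rotate) TreeTriangle-rotate
  TreeTriangle-reindex (there (there (there (there (there (here refl)))))) =
    mk⇔ (TreeTriangle-swap ∘ TreeTriangle-rotate) (TreeTriangle-swap ∘ TreeTriangle-rotate)

  TreeTriangle-↭ : ∀ {a b c} → (a ∷ b ∷ c ∷ []) ↭ (x ∷ y ∷ z ∷ []) → TreeTriangle x y z → TreeTriangle a b c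
  TreeTriangle-↭ π t with ↭-reindex π
  ... | _ , σ∈ , refl , refl , refl = Equivalence.to (TreeTriangle-reindex σ∈) t

OddOneOut : Index → Index → Index → Index → Set
OddOneOut i j k o = (i ≡ j × k ≡ o) ⊎ (i ≡ k × j ≡ o) ⊎ (j ≡ k × i ≡ o)

column : Vec Index 3 → Vec Index 3 → Index → Vec Index 3
column σ τ i = lookup σ i ∷ lookup τ i ∷ i ∷ []

Covered : Vec Index 3 → Vec Index 3 → Set
Covered σ τ = (∃[ i ] column σ τ i ∈ permutations) ⊎ (∀ o → ∃[ i ] OddOneOut (lookup σ i) (lookup τ i) i o)

OddOneOut? : ∀ i j k o → Dec (OddOneOut i j k o)
OddOneOut? i j k o =
  ((i ≟ᶠ j) ×-dec (k ≟ᶠ o)) ⊎-dec ((i ≟ᶠ k) ×-dec (j ≟ᶠ o)) ⊎-dec ((j ≟ᶠ k) ×-dec (i ≟ᶠ o))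

Covered? : ∀ σ τ → Dec (Covered σ τ)
Covered? σ τ =
  any? (λ i → column σ τ i ∈? permutations) ⊎-dec
  all? (λ o → any? (λ i → OddOneOut? (lookup σ i) (lookup τ i) i o))
  where
    open DecMembership (≡-dec _≟ᶠ_) using (_∈?_)

covered : ∀ {σ τ} → σ ∈ permutations → τ ∈ permutations → Covered σ τ
covered σ∈ τ∈ = All.lookup (All.lookup all-covered σ∈) τ∈
  where
    all-covered : All (λ σ → All (Covered σ) permutations) permutations
    all-covered = toWitness {a? = All.all? (λ σ → All.all? (Covered? σ) permutations) permutations} tt

module _ {p q r : ℕ} where

  private
    v : Vec ℕ 3
    v = p ∷ q ∷ r ∷ []

    s : Index → ℕ
    s = lookup v

  oddOneOut-even : ∀ {i j k o} → OddOneOut i j k o → TreeTriangle (s i) (s j) (s k) → 2 ∣ s o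
  oddOneOut-even (inj₁ (refl , refl)) t = even-of-isosceles t
  oddOneOut-even (inj₂ (inj₁ (refl , refl))) t =
    even-of-isosceles (TreeTriangle-rotate (TreeTriangle-rotate t))
  oddOneOut-even (inj₂ (inj₂ (refl , refl))) t = even-of-isosceles (TreeTriangle-rotate t)

  covered-columns : ∀ σ τ → Covered σ τ → (∀ i → TreeTriangle (reindexed v σ i) (reindexed v τ i) (s i)) →
    AllEven p q r ⊎ TreeTriangle p q r
  covered-columns σ τ (inj₁ (i , column∈)) t = inj₂ (Equivalence.from (TreeTriangle-reindex column∈) (t i))
  covered-columns σ τ (inj₂ cover) t = inj₁ (even (# 0) , even (# 1) , even (# 2))
    where
      even : ∀ o → 2 ∣ s o
      even o = let (i , odd) = cover o in oddOneOut-even odd (t i)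

TwoSteps : List ℕ → ℕ → ℕ → ℕ → Set
TwoSteps S c₁ c₂ c₃ = ∃[ a₁ ] ∃[ a₂ ] ∃[ a₃ ] ∃[ b₁ ] ∃[ b₂ ] ∃[ b₃ ]
  ((a₁ ∷ a₂ ∷ a₃ ∷ []) ↭ S × (b₁ ∷ b₂ ∷ b₃ ∷ []) ↭ S ×
   TreeTriangle a₁ b₁ c₁ × TreeTriangle a₂ b₂ c₂ × TreeTriangle a₃ b₃ c₃)

module _ {p q r : ℕ} where

  private
    S : List ℕ
    S = p ∷ q ∷ r ∷ []

  TwoSteps⇒allEven⊎treeTriangle : TwoSteps S p q r → AllEven p q r ⊎ TreeTriangle p q r
  TwoSteps⇒allEven⊎treeTriangle (_ , _ , _ , _ , _ , _ , a↭S , b↭S , t₁ , t₂ , t₃)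
    with ↭-reindex a↭S | ↭-reindex b↭S
  ... | σ , σ∈ , refl , refl , refl | τ , τ∈ , refl , refl , refl =
    covered-columns σ τ (covered σ∈ τ∈) λ { fzero → t₁ ; (fsuc fzero) → t₂ ; (fsuc (fsuc fzero)) → t₃ }

  allEven⊎treeTriangle⇒TwoSteps : AllEven p q r ⊎ TreeTriangle p q r →
    ∀ {c₁ c₂ c₃} → (c₁ ∷ c₂ ∷ c₃ ∷ []) ↭ S → TwoSteps S c₁ c₂ c₃
  allEven⊎treeTriangle⇒TwoSteps (inj₁ evens) {c₁} {c₂} {c₃} c↭S =
    c₁ , c₂ , c₃ , c₁ , c₂ , c₃ , c↭S , c↭S ,
    equilateral first , equilateral second , equilateral third
    where
      equilateral : ∀ {c} → c ∈ (c₁ ∷ c₂ ∷ c₃ ∷ []) → TreeTriangle c c c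
      equilateral c∈ = TreeTriangle-equilateral (even (∈-resp-↭ c↭S c∈))
        where
          even : ∀ {c} → c ∈ S → 2 ∣ c
          even (here refl) = proj₁ evens
          even (there (here refl)) = proj₁ (proj₂ evens)
          even (there (there (here refl))) = proj₂ (proj₂ evens)
  allEven⊎treeTriangle⇒TwoSteps (inj₂ tpqr) {c₁} {c₂} {c₃} c↭S =
    c₂ , c₃ , c₁ , c₃ , c₁ , c₂ ,
    ↭-trans (shift c₁ (c₂ ∷ c₃ ∷ []) []) c↭S , ↭-trans (↭-sym (shift c₃ (c₁ ∷ c₂ ∷ []) [])) c↭S ,
    TreeTriangle-rotate t , TreeTriangle-rotate (TreeTriangle-rotate t) , t
    where
      t : TreeTriangle c₁ c₂ c₃
      t = TreeTriangle-↭ c↭S tpqr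

unique-⊆ : ∀ {A : Set} {xs ys : List A} → xs ⊆ ys → Unique ys → Unique xs
unique-⊆ [] [] = []
unique-⊆ (_ ∷ʳ xs⊆ys) (_ ∷ ys!) = unique-⊆ xs⊆ys ys!
unique-⊆ (refl ∷ xs⊆ys) (y∉ys ∷ ys!) = All-resp-⊆ xs⊆ys y∉ys ∷ unique-⊆ xs⊆ys ys!

avoiding-two : ∀ {A : Set} → DecidableEquality A → (l : List A) → Unique l → 3 ≤ length l →
  (a₁ a₂ : A) → ∃[ y ] y ∈ l × y ≢ a₁ × y ≢ a₂
avoiding-two _ [] _ () _ _
avoiding-two _ (_ ∷ []) _ (s≤s ()) _ _
avoiding-two _ (_ ∷ _ ∷ []) _ (s≤s (s≤s ())) _ _
avoiding-two _≟_ (y₁ ∷ y₂ ∷ y₃ ∷ _) ((y₁≢y₂ ∷ y₁≢y₃ ∷ _) ∷ (y₂≢y₃ ∷ _) ∷ _) _ a₁ a₂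
  with y₁ ≟ a₁ | y₁ ≟ a₂
... | no y₁≢a₁ | no y₁≢a₂ = y₁ , here refl , y₁≢a₁ , y₁≢a₂
... | yes refl | _ with y₂ ≟ a₂
...   | no y₂≢a₂ = y₂ , there (here refl) , y₁≢y₂ ∘ sym , y₂≢a₂
...   | yes refl = y₃ , there (there (here refl)) , y₁≢y₃ ∘ sym , y₂≢y₃ ∘ sym
avoiding-two _≟_ (y₁ ∷ y₂ ∷ y₃ ∷ _) ((y₁≢y₂ ∷ y₁≢y₃ ∷ _) ∷ (y₂≢y₃ ∷ _) ∷ _) _ a₁ a₂
  | no _ | yes refl with y₂ ≟ a₁
...   | no y₂≢a₁ = y₂ , there (here refl) , y₂≢a₁ , y₁≢y₂ ∘ sym
...   | yes refl = y₃ , there (there (here refl)) , y₂≢y₃ ∘ sym , y₁≢y₃ ∘ sym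

module Walks {n : ℕ} (G : Graph n) where
  open Graph G

  private
    variable
      x y z m s : Fin n

  -- Unlike Walk, the length is computed rather than indexed, so that concatenation,
  -- reversal and splitting need no transport along arithmetic equations.
  infixr 5 _▸_
  data Walk′ : Fin n → Fin n → Set where
    ε   : Walk′ x x
    _▸_ : x ~ y → Walk′ y z → Walk′ x z

  len : Walk′ x y → ℕ
  len ε = 0
  len (_ ▸ w) = suc (len w)

  _++_ : Walk′ x y → Walk′ y z → Walk′ x z
  ε ++ v = v
  (e ▸ w) ++ v = e ▸ (w ++ v)

  reverse : Walk′ x y → Walk′ y x
  reverse ε = ε
  reverse (e ▸ w) = reverse w ++ (sym~ e ▸ ε)

  len-++ : (w : Walk′ x y) (v : Walk′ y z) → len (w ++ v) ≡ len w + len v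
  len-++ ε v = refl
  len-++ (e ▸ w) v = cong suc (len-++ w v)

  len-reverse : (w : Walk′ x y) → len (reverse w) ≡ len w
  len-reverse ε = refl
  len-reverse (e ▸ w) = trans (len-++ (reverse w) _) (trans (+-comm _ 1) (cong suc (len-reverse w)))

  len-reverse-++ : (w : Walk′ y x) (v : Walk′ y z) → len (reverse w ++ v) ≡ len w + len v
  len-reverse-++ w v = trans (len-++ (reverse w) v) (cong (_+ len v) (len-reverse w))

  len-++-reverse : (w : Walk′ x y) (v : Walk′ z y) → len (w ++ reverse v) ≡ len w + len v
  len-++-reverse w v = trans (len-++ w (reverse v)) (cong (len w +_) (len-reverse v))

  afterStart : Walk′ x y → Fin n
  afterStart {x} ε = x
  afterStart (_▸_ {y = y} _ _) = y

  beforeEnd : Walk′ x y → Fin n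
  beforeEnd {x} ε = x
  beforeEnd {x} (_ ▸ ε) = x
  beforeEnd (_ ▸ w@(_ ▸ _)) = beforeEnd w

  FirstStep≢ : Fin n → Walk′ x y → Set
  FirstStep≢ s ε = ⊤
  FirstStep≢ s (_▸_ {y = t} _ _) = t ≢ s

  NonBacktracking : Walk′ x y → Set
  NonBacktracking ε = ⊤
  NonBacktracking (_▸_ {x = x} _ w) = FirstStep≢ x w × NonBacktracking w

  FirstStep≢-start : (w : Walk′ x y) → FirstStep≢ x w
  FirstStep≢-start ε = tt
  FirstStep≢-start (e ▸ _) refl = irrefl~ e

  FirstStep≢-swap : (u : Walk′ m y) (v : Walk′ m z) →
    FirstStep≢ (afterStart v) u → FirstStep≢ (afterStart u) v
  FirstStep≢-swap ε v _ = FirstStep≢-start v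
  FirstStep≢-swap (_ ▸ _) ε _ = tt
  FirstStep≢-swap (_ ▸ _) (_ ▸ _) t≢t′ = t≢t′ ∘ sym

  ++-nonBacktracking : (u : Walk′ x y) {v : Walk′ y z} → NonBacktracking u → NonBacktracking v →
    FirstStep≢ (beforeEnd u) v → NonBacktracking (u ++ v)
  ++-nonBacktracking ε _ nv _ = nv
  ++-nonBacktracking (_ ▸ ε) _ nv junction = junction , nv
  ++-nonBacktracking (_ ▸ u@(_ ▸ _)) (k , nu) nv junction = k , ++-nonBacktracking u nu nv junction

  ++-nonBacktracking⁻ : (u : Walk′ x y) {v : Walk′ y z} → NonBacktracking (u ++ v) →
    NonBacktracking u × NonBacktracking v
  ++-nonBacktracking⁻ ε nv = tt , nv
  ++-nonBacktracking⁻ (_ ▸ ε) (_ , nv) = (tt , tt) , nv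
  ++-nonBacktracking⁻ (_ ▸ u@(_ ▸ _)) (k , nuv) =
    let nu , nv = ++-nonBacktracking⁻ u nuv in (k , nu) , nv

  beforeEnd-++-step : (u : Walk′ x y) (e : y ~ z) → beforeEnd (u ++ (e ▸ ε)) ≡ y
  beforeEnd-++-step ε e = refl
  beforeEnd-++-step (_ ▸ ε) e = refl
  beforeEnd-++-step (_ ▸ u@(_ ▸ _)) e = beforeEnd-++-step u e

  beforeEnd-reverse : (w : Walk′ x y) → beforeEnd (reverse w) ≡ afterStart w
  beforeEnd-reverse ε = refl
  beforeEnd-reverse (e ▸ w) = beforeEnd-++-step (reverse w) (sym~ e)

  reverse-nonBacktracking : (w : Walk′ x y) → NonBacktracking w → NonBacktracking (reverse w)
  reverse-nonBacktracking ε _ = tt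
  reverse-nonBacktracking (_ ▸ ε) _ = tt , tt
  reverse-nonBacktracking (_ ▸ w@(_ ▸ _)) (t≢x , nw) =
    ++-nonBacktracking (reverse w) (reverse-nonBacktracking w nw) (tt , tt)
      (λ x≡b → t≢x (sym (trans x≡b (beforeEnd-reverse w))))

  record Reduction (w : Walk′ x y) : Set where
    constructor reduction
    field
      reduced : Walk′ x y
      reduced-nonBacktracking : NonBacktracking reduced
      excess : ℕ
      len-reduction : len w ≡ len reduced + 2 * excess

    len-reduced-≤ : len reduced ≤ len w
    len-reduced-≤ = subst (len reduced ≤_) (sym len-reduction) (m≤m+n (len reduced) (2 * excess))

  reduce : (w : Walk′ x y) → Reduction w
  reduce ε = reduction ε tt 0 refl
  reduce (_▸_ {x = x} e w) with reduce w
  ... | reduction ε _ k eq = reduction (e ▸ ε) (tt , tt) k (cong suc eq)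
  ... | reduction (_▸_ {y = t} f v) nv k eq with t ≟ᶠ x
  ...   | yes refl = reduction v (proj₂ nv) (suc k) (trans (cong suc eq) (backtrack (len v) k))
    where
      backtrack : ∀ l k → suc (suc l + 2 * k) ≡ l + 2 * suc k
      backtrack = solve-∀
  ...   | no t≢x = reduction (e ▸ f ▸ v) (t≢x , nv) k (cong suc eq)

  vertices : Walk′ x y → List (Fin n)
  vertices {x} ε = x ∷ []
  vertices {x} (_ ▸ w) = x ∷ vertices w

  length-vertices : (w : Walk′ x y) → length (vertices w) ≡ suc (len w)
  length-vertices ε = refl
  length-vertices (_ ▸ w) = cong suc (length-vertices w)

  last-vertices : (w : Walk′ x y) → last (vertices w) ≡ just y
  last-vertices ε = refl
  last-vertices (_ ▸ ε) = refl
  last-vertices (_ ▸ w@(_ ▸ _)) = last-vertices w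

  linked-vertices : (w : Walk′ x y) → Linked _~_ (vertices w)
  linked-vertices ε = [-]
  linked-vertices (e ▸ ε) = e ∷ [-]
  linked-vertices (e ▸ w@(_ ▸ _)) = e ∷ linked-vertices w

  end∈vertices : (w : Walk′ x y) → y ∈ vertices w
  end∈vertices ε = here refl
  end∈vertices (_ ▸ w) = there (end∈vertices w)

  prefix : (w : Walk′ x z) → y ∈ vertices w →
    Σ (Walk′ x y) λ u → vertices u ⊆ vertices w × (FirstStep≢ s w → FirstStep≢ s u)
  prefix ε (here refl) = ε , refl ∷ [] , λ _ → tt
  prefix (_ ▸ w) (here refl) = ε , refl ∷ minimum _ , λ _ → tt
  prefix {s = s} (e ▸ w) (there y∈w) =
    let u , u⊆w , _ = prefix {s = s} w y∈w in e ▸ u , refl ∷ u⊆w , id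

  cycle-through-start : (e : x ~ y) (w : Walk′ y z) → FirstStep≢ x w → Unique (vertices w) →
    x ∈ vertices w → ∃[ k ] (HasCycle G k × k ≤ len (e ▸ w))
  cycle-through-start e w w-no-return w! x∈w with prefix w x∈w
  ... | ε , _ , _ = ⊥-elim (irrefl~ e)
  ... | _ ▸ ε , _ , first-step = ⊥-elim (first-step w-no-return refl)
  ... | u@(_ ▸ _ ▸ _) , u⊆w , _ =
    suc (len u) ,
    (vertices u , length-vertices u , s≤s (s≤s (s≤s z≤n)) , unique-⊆ u⊆w w! , linked-vertices u ,
      (_ , _ , refl , last-vertices u , e)) ,
    subst₂ _≤_ (length-vertices u) (length-vertices w) (length-mono-≤ u⊆w)

  unique-vertices⊎cycle : (w : Walk′ x y) → NonBacktracking w →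
    Unique (vertices w) ⊎ ∃[ k ] (HasCycle G k × k ≤ len w)
  unique-vertices⊎cycle ε _ = inj₁ ([] ∷ [])
  unique-vertices⊎cycle (_▸_ {x = x} e w) (w-no-return , nw) with unique-vertices⊎cycle w nw
  ... | inj₂ (k , cycle , k≤) = inj₂ (k , cycle , m≤n⇒m≤1+n k≤)
  ... | inj₁ w! with x ∈? vertices w
    where open DecMembership _≟ᶠ_ using (_∈?_)
  ...   | yes x∈w = inj₂ (cycle-through-start e w w-no-return w! x∈w)
  ...   | no x∉w = inj₁ (¬Any⇒All¬ _ x∉w ∷ w!)

  closed⇒cycle : (c : Walk′ x x) → NonBacktracking c → 1 ≤ len c → ∃[ k ] (HasCycle G k × k ≤ len c)
  closed⇒cycle (e ▸ w) (w-no-return , nw) _ with unique-vertices⊎cycle w nw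
  ... | inj₁ w! = cycle-through-start e w w-no-return w! (end∈vertices w)
  ... | inj₂ (k , cycle , k≤) = k , cycle , m≤n⇒m≤1+n k≤

  splitAt : (w : Walk′ x y) (k l : ℕ) → len w ≡ k + l →
    ∃[ m ] Σ (Walk′ x m) λ u → Σ (Walk′ m y) λ v → len u ≡ k × len v ≡ l × u ++ v ≡ w
  splitAt w zero l eq = _ , ε , w , refl , eq , refl
  splitAt (e ▸ w) (suc k) l eq =
    let m , u , v , eu , ev , u++v≡w = splitAt w k l (suc-injective eq)
    in m , e ▸ u , v , cong suc eu , ev , cong (e ▸_) u++v≡w

  indexed : (w : Walk′ x y) → Walk G x y (len w)
  indexed ε = nil
  indexed (e ▸ w) = cons e (indexed w)

  unindexed : ∀ {k} → Walk G x y k → Σ (Walk′ x y) λ w → len w ≡ k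
  unindexed nil = ε , refl
  unindexed (cons e walk) = let w , eq = unindexed walk in e ▸ w , cong suc eq

  Dist-≤ : ∀ {k} → Dist G x y k → (w : Walk′ x y) → k ≤ len w
  Dist-≤ (_ , minimal) w = ≮⇒≥ λ w<k → minimal (len w) w<k (indexed w)

  Dist⇒nonBacktracking : ∀ {k} → Dist G x y k → Σ (Walk′ x y) λ w → NonBacktracking w × len w ≡ k
  Dist⇒nonBacktracking D with unindexed (proj₁ D)
  ... | w , refl = let open Reduction (reduce w) in
    reduced , reduced-nonBacktracking , ≤-antisym len-reduced-≤ (Dist-≤ D reduced)

  module _ (d : ℕ) (3≤d : 3 ≤ d) (regular : Regular G d) where

    neighbour-avoiding : (x a₁ a₂ : Fin n) → ∃[ y ] x ~ y × y ≢ a₁ × y ≢ a₂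
    neighbour-avoiding x a₁ a₂ =
      let ns , length≡d , ns! , adjacent , _ = regular x
          y , y∈ns , y≢a₁ , y≢a₂ = avoiding-two _≟ᶠ_ ns ns! (subst (3 ≤_) (sym length≡d) 3≤d) a₁ a₂
      in y , adjacent y y∈ns , y≢a₁ , y≢a₂

    nonBacktracking-extension : (l : ℕ) (m a₁ a₂ : Fin n) →
      ∃[ z ] Σ (Walk′ m z) λ w → NonBacktracking w × len w ≡ l × FirstStep≢ a₁ w × FirstStep≢ a₂ w
    nonBacktracking-extension zero m _ _ = m , ε , tt , refl , tt , tt
    nonBacktracking-extension (suc l) m a₁ a₂ =
      let y , m~y , y≢a₁ , y≢a₂ = neighbour-avoiding m a₁ a₂
          z , w , nw , len≡l , w-leaves-m , _ = nonBacktracking-extension l y m m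
      in z , m~y ▸ w , (w-leaves-m , nw) , cong suc len≡l , y≢a₁ , y≢a₂

  module _ {g : ℕ} (girth : GirthGreaterThan G g) where

    closed-nonBacktracking-long : (c : Walk′ x x) → NonBacktracking c → 1 ≤ len c → g < len c
    closed-nonBacktracking-long c nc 1≤len with closed⇒cycle c nc 1≤len
    ... | k , cycle , k≤len = <-≤-trans (girth k cycle) k≤len

    -- Two different non-backtracking walks between the same ends would close up into a
    -- non-backtracking closed walk through their first point of divergence.
    nonBacktracking-len-unique : (w v : Walk′ x y) → NonBacktracking w → NonBacktracking v →
      len w + len v ≤ g → len w ≡ len v
    nonBacktracking-len-unique ε ε _ _ _ = refl
    nonBacktracking-len-unique ε (f ▸ v) _ nv ≤g =
      ⊥-elim (<⇒≱ (closed-nonBacktracking-long (f ▸ v) nv (s≤s z≤n)) ≤g)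
    nonBacktracking-len-unique (e ▸ w) ε nw _ ≤g =
      ⊥-elim (<⇒≱ (closed-nonBacktracking-long (e ▸ w) nw (s≤s z≤n)) (subst (_≤ g) (+-identityʳ _) ≤g))
    nonBacktracking-len-unique {y = y} (_▸_ {y = a} e w) (_▸_ {y = b} f v) (w-no-return , nw)
      (v-no-return , nv) ≤g with a ≟ᶠ b
    ... | yes refl =
      cong suc (nonBacktracking-len-unique w v nw nv (≤-trans (+-mono-≤ (n≤1+n _) (n≤1+n _)) ≤g))
    ... | no a≢b =
      ⊥-elim (<⇒≱ (closed-nonBacktracking-long loop nloop (subst (1 ≤_) (sym len-loop) (s≤s z≤n)))
                  (subst (_≤ g) (sym len-loop) ≤g))
      where
        loop : Walk′ y y
        loop = reverse (e ▸ w) ++ (f ▸ v)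
        nloop : NonBacktracking loop
        nloop = ++-nonBacktracking (reverse (e ▸ w))
          (reverse-nonBacktracking (e ▸ w) (w-no-return , nw)) (v-no-return , nv)
          (λ b≡ → a≢b (sym (trans b≡ (beforeEnd-reverse (e ▸ w)))))
        len-loop : len loop ≡ len (e ▸ w) + len (f ▸ v)
        len-loop = len-reverse-++ (e ▸ w) (f ▸ v)

    nonBacktracking⇒Dist : ∀ {k} (w : Walk′ x y) → NonBacktracking w → len w ≡ k → k + k ≤ g → Dist G x y k
    nonBacktracking⇒Dist {x = x} {y = y} w nw refl 2k≤g = indexed w , no-shorter
      where
        no-shorter : ∀ j → j < len w → ¬ Walk G x y j
        no-shorter j j<len walk with unindexed walk
        ... | v , refl =
          let open Reduction (reduce v)
              v′≤w = ≤-trans len-reduced-≤ (<⇒≤ j<len)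
              same = nonBacktracking-len-unique w reduced nw reduced-nonBacktracking
                       (≤-trans (+-monoʳ-≤ (len w) v′≤w) 2k≤g)
          in <⇒≱ j<len (subst (_≤ len v) (sym same) len-reduced-≤)

    closed-even : (c : Walk′ x x) → len c ≤ g → 2 ∣ len c
    closed-even c ≤g with reduce c
    ... | reduction ε _ k eq = divides k (trans eq (*-comm 2 k))
    ... | reduction (e ▸ w) nw k eq =
      ⊥-elim (<⇒≱ (closed-nonBacktracking-long (e ▸ w) nw (s≤s z≤n))
                  (≤-trans (m≤m+n _ _) (subst (_≤ g) eq ≤g)))

    Dist-treeTriangle : ∀ {a b c} → Dist G x z a → Dist G z y b → Dist G x y c → a + b + c ≤ g →
      TreeTriangle a b c
    Dist-treeTriangle {x = x} A B C ≤g with unindexed (proj₁ A) | unindexed (proj₁ B) | unindexed (proj₁ C)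
    ... | α , refl | β , refl | γ , refl =
      subst (2 ∣_) len-loop (closed-even loop (subst (_≤ g) (sym len-loop) ≤g)) ,
      subst (_ ≤_) (trans (len-++-reverse γ β) (+-comm (len γ) (len β))) (Dist-≤ A (γ ++ reverse β)) ,
      subst (_ ≤_) (len-reverse-++ α γ) (Dist-≤ B (reverse α ++ γ)) ,
      subst (_ ≤_) (len-++ α β) (Dist-≤ C (α ++ β))
      where
        loop : Walk′ x x
        loop = (α ++ β) ++ reverse γ
        len-loop : len loop ≡ len α + len β + len γ
        len-loop = trans (len-++-reverse (α ++ β) γ) (cong (_+ len γ) (len-++ α β))

    module _ {d : ℕ} (3≤d : 3 ≤ d) (regular : Regular G d) where

      ∃-at-distance : ∀ x k → k + k ≤ g → ∃[ y ] Dist G x y k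
      ∃-at-distance x k 2k≤g =
        let y , w , nw , len≡k , _ = nonBacktracking-extension d 3≤d regular k x x x
        in y , nonBacktracking⇒Dist w nw len≡k 2k≤g

      -- Grow the third leg of the tripod at the point m of a geodesic from x to y,
      -- leaving m through neither of the two geodesic edges at m.
      tripod : ∀ {a b c} → Dist G x y c → TreeTriangle a b c → a + a ≤ g → b + b ≤ g →
        ∃[ z ] Dist G x z a × Dist G z y b
      tripod D t 2a≤g 2b≤g with tripod-legs t
      ... | k , l , h , refl , refl , refl with Dist⇒nonBacktracking D
      ... | γ , nγ , len-γ with splitAt γ k l len-γ
      ... | m , u , v , refl , refl , refl
          with ++-nonBacktracking⁻ u nγ
             | nonBacktracking-extension d 3≤d regular h m (beforeEnd u) (afterStart v)
      ... | nu , nv | z , ℓ , nℓ , refl , ℓ-leaves-u , ℓ-leaves-v =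
        z ,
        nonBacktracking⇒Dist (u ++ ℓ) (++-nonBacktracking u nu nℓ ℓ-leaves-u) (len-++ u ℓ) 2a≤g ,
        nonBacktracking⇒Dist (reverse ℓ ++ v) nℓv (trans (len-reverse-++ ℓ v) (+-comm (len ℓ) (len v))) 2b≤g
        where
          nℓv : NonBacktracking (reverse ℓ ++ v)
          nℓv = ++-nonBacktracking (reverse ℓ) (reverse-nonBacktracking ℓ nℓ) nv
            (subst (λ s → FirstStep≢ s v) (sym (beforeEnd-reverse ℓ)) (FirstStep≢-swap ℓ v ℓ-leaves-v))

module CommonNeighbours {n : ℕ} {G : Graph n} {d : ℕ} (3≤d : 3 ≤ d) (regular : Regular G d) {p q r : ℕ}
         (girth : GirthGreaterThan G (3 * max3 p q r)) where

  open Walks G using (Dist-treeTriangle; tripod)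

  private
    M : ℕ
    M = max3 p q r

    S : List ℕ
    S = p ∷ q ∷ r ∷ []

    ≤M : ∀ {a} → a ∈ S → a ≤ M
    ≤M (here refl) = m≤m⊔n p (q ⊔ r)
    ≤M (there (here refl)) = ≤-trans (m≤m⊔n q r) (m≤n⊔m p (q ⊔ r))
    ≤M (there (there (here refl))) = ≤-trans (m≤n⊔m q r) (m≤n⊔m p (q ⊔ r))

    three-≤ : ∀ {a b c} → a ∈ S → b ∈ S → c ∈ S → a + b + c ≤ 3 * M
    three-≤ a∈ b∈ c∈ = ≤-trans (+-mono-≤ (+-mono-≤ (≤M a∈) (≤M b∈)) (≤M c∈)) (≤-reflexive (triple M))
      where
        triple : ∀ M → M + M + M ≡ 3 * M
        triple = solve-∀

    two-≤ : ∀ {a} → a ∈ S → a + a ≤ 3 * M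
    two-≤ {a} a∈ = ≤-trans (m≤m+n (a + a) a) (three-≤ a∈ a∈ a∈)

  common-neighbour⇒TwoSteps : ∀ {x₁ x₂ x₃ y₁ y₂ y₃ c₁ c₂ c₃ Z} →
    Dist G x₁ y₁ c₁ → Dist G x₂ y₂ c₂ → Dist G x₃ y₃ c₃ → (c₁ ∷ c₂ ∷ c₃ ∷ []) ↭ S →
    AdjS G p q r (x₁ , x₂ , x₃) Z → AdjS G p q r Z (y₁ , y₂ , y₃) → TwoSteps S c₁ c₂ c₃
  common-neighbour⇒TwoSteps C₁ C₂ C₃ c↭S
    (a₁ , a₂ , a₃ , A₁ , A₂ , A₃ , a↭S) (b₁ , b₂ , b₃ , B₁ , B₂ , B₃ , b↭S) =
    a₁ , a₂ , a₃ , b₁ , b₂ , b₃ , a↭S , b↭S ,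
    triangle A₁ B₁ C₁ (∈-resp-↭ a↭S first) (∈-resp-↭ b↭S first) (∈-resp-↭ c↭S first) ,
    triangle A₂ B₂ C₂ (∈-resp-↭ a↭S second) (∈-resp-↭ b↭S second) (∈-resp-↭ c↭S second) ,
    triangle A₃ B₃ C₃ (∈-resp-↭ a↭S third) (∈-resp-↭ b↭S third) (∈-resp-↭ c↭S third)
    where
      triangle : ∀ {x y z a b c} → Dist G x z a → Dist G z y b → Dist G x y c →
        a ∈ S → b ∈ S → c ∈ S → TreeTriangle a b c
      triangle A B C a∈ b∈ c∈ = Dist-treeTriangle girth A B C (three-≤ a∈ b∈ c∈)

  TwoSteps⇒common-neighbour : ∀ {x₁ x₂ x₃ y₁ y₂ y₃ c₁ c₂ c₃} →
    Dist G x₁ y₁ c₁ → Dist G x₂ y₂ c₂ → Dist G x₃ y₃ c₃ → TwoSteps S c₁ c₂ c₃ →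
    ∃[ Z ] (AdjS G p q r (x₁ , x₂ , x₃) Z × AdjS G p q r Z (y₁ , y₂ , y₃))
  TwoSteps⇒common-neighbour C₁ C₂ C₃ (a₁ , a₂ , a₃ , b₁ , b₂ , b₃ , a↭S , b↭S , t₁ , t₂ , t₃)
    with tripod′ C₁ t₁ (∈-resp-↭ a↭S first) (∈-resp-↭ b↭S first)
       | tripod′ C₂ t₂ (∈-resp-↭ a↭S second) (∈-resp-↭ b↭S second)
       | tripod′ C₃ t₃ (∈-resp-↭ a↭S third) (∈-resp-↭ b↭S third)
    where
      tripod′ : ∀ {x y a b c} → Dist G x y c → TreeTriangle a b c → a ∈ S → b ∈ S →
        ∃[ z ] Dist G x z a × Dist G z y b
      tripod′ C t a∈ b∈ = tripod girth 3≤d regular C t (two-≤ a∈) (two-≤ b∈)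
  ... | z₁ , A₁ , B₁ | z₂ , A₂ , B₂ | z₃ , A₃ , B₃ =
    (z₁ , z₂ , z₃) , (a₁ , a₂ , a₃ , A₁ , A₂ , A₃ , a↭S) , (b₁ , b₂ , b₃ , B₁ , B₂ , B₃ , b↭S)

  ∃-at-distance-S : ∀ x {c} → c ∈ S → ∃[ y ] Dist G x y c
  ∃-at-distance-S x c∈ = Walks.∃-at-distance G girth 3≤d regular x _ (two-≤ c∈)

claim3p3 : (d n : ℕ) → 3 ≤ d → 0 < n → (G : Graph n) → Regular G d →
    (p q r : ℕ) → GirthGreaterThan G (3 * max3 p q r) →
    LinkDegreeNonzero G p q r ⇔ (AllEven p q r ⊎ (2 ∣ (p + q + r) × TriangleIneq p q r))
claim3p3 d (suc n) 3≤d _ G regular p q r girth = mk⇔ nonzero⇒ ⇒nonzero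
  where
    open CommonNeighbours 3≤d regular {p} {q} {r} girth

    nonzero⇒ : LinkDegreeNonzero G p q r → AllEven p q r ⊎ TreeTriangle p q r
    nonzero⇒ link-degree
      with ∃-at-distance-S fzero first | ∃-at-distance-S fzero second | ∃-at-distance-S fzero third
    ... | y₁ , D₁ | y₂ , D₂ | y₃ , D₃
      with link-degree _ (y₁ , y₂ , y₃) (p , q , r , D₁ , D₂ , D₃ , ↭-refl)
    ... | Z , X~Z , Z~Y = TwoSteps⇒allEven⊎treeTriangle
      (common-neighbour⇒TwoSteps D₁ D₂ D₃ ↭-refl X~Z Z~Y)

    ⇒nonzero : AllEven p q r ⊎ TreeTriangle p q r → LinkDegreeNonzero G p q r
    ⇒nonzero characterisation _ _ (c₁ , c₂ , c₃ , C₁ , C₂ , C₃ , c↭S) =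
      TwoSteps⇒common-neighbour C₁ C₂ C₃ (allEven⊎treeTriangle⇒TwoSteps characterisation c↭S)
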